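{- For every non-negative integer $N$, \[\sum_{\pi\in\mathcal{D}_{\le N}} q^{\mathcal{O}(\pi)} = \sum_{\pi\in\mathcal{RR}_{\le N}} \omega(\pi)\, q^{|\pi|},\] where for $\pi=(\lambda_1,\dots,\lambda_k)$ with $k\ge1$ parts, $\omega(\pi)=\lambda_k\prod_{i=1}^{k-1}(\lambda_i-\lambda_{i+1}-1)$, and $\omega(\emptyset)=1$.
   Context: A partition $\pi=(\lambda_1,\lambda_2,\dots)$ is a finite non-increasing sequence of positive integers; the empty sequence is the unique partition of $0$; $|\pi|$ is the sum of its parts. $\mathcal{D}_{\le N}$ is the set of partitions into distinct parts all $\le N$. $\mathcal{RR}_{\le N}$ is the set of partitions into parts $\le N$ in which consecutive parts differ by at least $2$. $\mathcal{O}(\pi)=\lambda_1+\lambda_3+\lambda_5+\cdots$. -}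

module Defs where

open import Data.Nat using (ℕ; zero; suc; _+_; _*_; _∸_; _^_; _≤_; _<_; _≡ᵇ_)
open import Data.Bool using (Bool; true; false; if_then_else_)
open import Data.List using (List; []; _∷_)
open import Data.Nat.ListAction using (sum)
open import Data.Product using (_×_)

Partition : Set
Partition = List ℕ

size : Partition → ℕ
size = sum

oddSum : Partition → ℕ
evenSum : Partition → ℕ
oddSum [] = 0
oddSum (x ∷ xs) = x + evenSum xs
evenSum [] = 0
evenSum (x ∷ xs) = oddSum xs

data Gap (d : ℕ) : Partition → Set where
  gap[]  : Gap d []
  gap[_] : ∀ x → Gap d (x ∷ [])
  gap∷   : ∀ {x y ys} → y + d ≤ x → Gap d (y ∷ ys) → Gap d (x ∷ y ∷ ys)

data PartsIn (N : ℕ) : Partition → Set where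
  []  : PartsIn N []
  _∷_ : ∀ {x xs} → 1 ≤ x → x ≤ N → PartsIn N xs → PartsIn N (x ∷ xs)

-- 𝒟_{≤N}: partitions into distinct parts, all ≤ N
-- (parts positive, listed in decreasing order)
InD : ℕ → Partition → Set
InD N π = Gap 1 π × PartsIn N π

InRR : ℕ → Partition → Set
InRR N π = Gap 2 π × PartsIn N π

ω : Partition → ℕ
ω [] = 1
ω (x ∷ []) = x
ω (x ∷ y ∷ ys) = (x ∸ y ∸ 1) * ω (y ∷ ys)

-- A polynomial in q with ℕ coefficients, as its coefficient function.
-- Generating polynomial Σ_{π ∈ S} w(π) q^{e(π)} over a finite set S
-- given as a list without repetitions: coefficient of qⁿ.
coeff : List Partition → (Partition → ℕ) → (Partition → ℕ) → ℕ → ℕ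
coeff [] w e n = 0
coeff (π ∷ πs) w e n = (if e π ≡ᵇ n then w π else 0) + coeff πs w e n

-- The odd-indexed parts μ = (λ₁, λ₃, λ₅, …) of a partition π into distinct parts ≤ N
-- form a partition in ℛℛ_{≤N} with |μ| = 𝒪(π). Conversely, π is recovered from μ by
-- choosing each λ₂ᵢ strictly between μᵢ and μᵢ₊₁ (μᵢ − μᵢ₊₁ − 1 choices) and a last
-- even-indexed part below μ_k or none (μ_k choices). So the fibre over μ has ω(μ)
-- elements, and regrouping the sum over 𝒟_{≤N} fibrewise gives the identity.
module Submission where

open import Defs
open import Data.Nat using (ℕ; zero; suc; _+_; _*_; _∸_; _≤_; _<_; _≡ᵇ_; z≤n; s≤s)
open import Data.Nat.Properties
open import Data.Nat.ListAction using (sum)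
open import Data.Nat.ListAction.Properties using (sum-++; sum-↭)
open import Data.Bool using (true; false; if_then_else_)
open import Data.List using (List; []; _∷_; _++_; map; length; concatMap; applyUpTo; cartesianProductWith)
open import Data.List.Properties using (map-++; map-cong; length-map; length-++; length-applyUpTo)
open import Data.List.Membership.Propositional using (_∈_; find; lose)
open import Data.List.Membership.Propositional.Properties
  using (∈-applyUpTo⁺; ∈-applyUpTo⁻; ∈-cartesianProductWith⁺; ∈-cartesianProductWith⁻; ∈-concatMap⁺; ∈-concatMap⁻)
open import Data.List.Membership.Propositional.Properties.WithK using (unique∧set⇒bag)
open import Data.List.Relation.Unary.Any using (here; there)
open import Data.List.Relation.Unary.All as All using ()
import Data.List.Relation.Unary.All.Properties as All
import Data.List.Relation.Unary.AllPairs as AllPairs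
import Data.List.Relation.Unary.AllPairs.Properties as AllPairs
open import Data.List.Relation.Unary.Unique.Propositional using (Unique; []; _∷_)
open import Data.List.Relation.Unary.Unique.Propositional.Properties
  using (concat⁺; applyUpTo⁺₁; cartesianProductWith⁺)
open import Data.List.Relation.Binary.Permutation.Propositional using (_↭_)
import Data.List.Relation.Binary.Permutation.Propositional.Properties as ↭
open import Data.List.Relation.Binary.BagAndSetEquality using (∼bag⇒↭)
open import Data.Product using (∃; _×_; _,_; proj₂)
open import Function using (_∘_)
open import Function.Bundles using (_⇔_; mk⇔; Equivalence)
import Function.Properties.Equivalence as ⇔
open import Relation.Binary.PropositionalEquality

private
  variable
    A B : Set
    N : ℕ
    π μ : Partition

term : (Partition → ℕ) → (Partition → ℕ) → ℕ → Partition → ℕ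
term w e n π = if e π ≡ᵇ n then w π else 0

module _ (w e : Partition → ℕ) (n : ℕ) where

  coeff≡sum : ∀ πs → coeff πs w e n ≡ sum (map (term w e n) πs)
  coeff≡sum []       = refl
  coeff≡sum (π ∷ πs) = cong (term w e n π +_) (coeff≡sum πs)

  coeff-↭ : ∀ {πs ρs} → πs ↭ ρs → coeff πs w e n ≡ coeff ρs w e n
  coeff-↭ {πs} {ρs} πs↭ρs = begin
    coeff πs w e n               ≡⟨ coeff≡sum πs ⟩
    sum (map (term w e n) πs)    ≡⟨ sum-↭ (↭.map⁺ (term w e n) πs↭ρs) ⟩
    sum (map (term w e n) ρs)    ≡⟨ coeff≡sum ρs ⟨
    coeff ρs w e n               ∎
    where open ≡-Reasoning

  coeff-++ : ∀ πs ρs → coeff (πs ++ ρs) w e n ≡ coeff πs w e n + coeff ρs w e n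
  coeff-++ πs ρs = begin
    coeff (πs ++ ρs) w e n                                   ≡⟨ coeff≡sum (πs ++ ρs) ⟩
    sum (map (term w e n) (πs ++ ρs))                        ≡⟨ cong sum (map-++ (term w e n) πs ρs) ⟩
    sum (map (term w e n) πs ++ map (term w e n) ρs)         ≡⟨ sum-++ (map (term w e n) πs) _ ⟩
    sum (map (term w e n) πs) + sum (map (term w e n) ρs)    ≡⟨ cong₂ _+_ (coeff≡sum πs) (coeff≡sum ρs) ⟨
    coeff πs w e n + coeff ρs w e n                          ∎
    where open ≡-Reasoning

  coeff-concatMap : (F : A → List Partition) → ∀ xs →
                    coeff (concatMap F xs) w e n ≡ sum (map (λ x → coeff (F x) w e n) xs)
  coeff-concatMap F []       = refl
  coeff-concatMap F (x ∷ xs) =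
    trans (coeff-++ (F x) (concatMap F xs)) (cong (coeff (F x) w e n +_) (coeff-concatMap F xs))

coeff-constExponent : ∀ (e : Partition → ℕ) k n πs → (∀ {π} → π ∈ πs → e π ≡ k) →
                      coeff πs (λ _ → 1) e n ≡ (if k ≡ᵇ n then length πs else 0)
coeff-constExponent e k n []       e≡k with k ≡ᵇ n
... | true  = refl
... | false = refl
coeff-constExponent e k n (π ∷ πs) e≡k
  rewrite e≡k (here refl) | coeff-constExponent e k n πs (λ π∈πs → e≡k (there π∈πs)) with k ≡ᵇ n
... | true  = refl
... | false = refl

unique-⇔⇒↭ : {xs ys : List A} → Unique xs → Unique ys → (∀ {x} → x ∈ xs ⇔ x ∈ ys) → xs ↭ ys
unique-⇔⇒↭ xs! ys! xs⇔ys = ∼bag⇒↭ (unique∧set⇒bag xs! ys! xs⇔ys)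

concatMap-unique : ∀ (F : A → List B) {xs} → Unique xs → (∀ x → Unique (F x)) →
                   (∀ {x y v} → v ∈ F x → v ∈ F y → x ≡ y) → Unique (concatMap F xs)
concatMap-unique F {xs} xs! F! F-disjoint =
  concat⁺ (All.map⁺ (All.universal F! xs))
          (AllPairs.map⁺ (AllPairs.map (λ x≢y {_} (v∈Fx , v∈Fy) → x≢y (F-disjoint v∈Fx v∈Fy)) xs!))

length-cartesianProductWith : ∀ {C : Set} (f : A → B → C) xs ys →
                              length (cartesianProductWith f xs ys) ≡ length xs * length ys
length-cartesianProductWith f []       ys = refl
length-cartesianProductWith f (x ∷ xs) ys = begin
  length (map (f x) ys ++ cartesianProductWith f xs ys)
    ≡⟨ length-++ (map (f x) ys) ⟩
  length (map (f x) ys) + length (cartesianProductWith f xs ys)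
    ≡⟨ cong₂ _+_ (length-map (f x) ys) (length-cartesianProductWith f xs ys) ⟩
  length ys + length xs * length ys
    ∎
  where open ≡-Reasoning

<⇒+1≤ : ∀ {m n} → m < n → m + 1 ≤ n
<⇒+1≤ {m} {n} = subst (_≤ n) (+-comm 1 m)

+1≤⇒< : ∀ {m n} → m + 1 ≤ n → m < n
+1≤⇒< {m} {n} = subst (_≤ n) (+-comm m 1)

+-≤-trans : ∀ {a b c} m k → a + m ≤ b → b + k ≤ c → a + (m + k) ≤ c
+-≤-trans {a} {b} {c} m k a+m≤b b+k≤c = begin
  a + (m + k)  ≡⟨ +-assoc a m k ⟨
  a + m + k    ≤⟨ +-monoˡ-≤ k a+m≤b ⟩
  b + k        ≤⟨ b+k≤c ⟩
  c            ∎
  where open ≤-Reasoning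

<∸⇒+< : ∀ {i a} n → i < a ∸ n → n + i < a
<∸⇒+< {i} {a}     zero    i<a   = i<a
<∸⇒+< {i} {suc a} (suc n) i<a∸n = s≤s (<∸⇒+< n i<a∸n)

∸-suc : ∀ a b → a ∸ b ∸ 1 ≡ a ∸ suc b
∸-suc a b = trans (∸-+-assoc a b 1) (cong (a ∸_) (+-comm b 1))

strictlyBetween : ℕ → ℕ → List ℕ
strictlyBetween b a = applyUpTo (suc b +_) (a ∸ b ∸ 1)

∈-strictlyBetween⁺ : ∀ {b c a} → b < c → c < a → c ∈ strictlyBetween b a
∈-strictlyBetween⁺ {b} {c} {a} b<c c<a =
  subst (_∈ strictlyBetween b a) (m+[n∸m]≡n b<c)
    (∈-applyUpTo⁺ (suc b +_) (subst (c ∸ suc b <_) (sym (∸-suc a b)) (∸-monoˡ-< c<a b<c)))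

∈-strictlyBetween⁻ : ∀ {b c a} → c ∈ strictlyBetween b a → b < c × c < a
∈-strictlyBetween⁻ {b} {c} {a} c∈ with ∈-applyUpTo⁻ (suc b +_) c∈
... | i , i<a∸b∸1 , refl = s≤s (m≤m+n b i) , <∸⇒+< (suc b) (subst (i <_) (∸-suc a b) i<a∸b∸1)

strictlyBetween-unique : ∀ b a → Unique (strictlyBetween b a)
strictlyBetween-unique b a =
  applyUpTo⁺₁ (suc b +_) (a ∸ b ∸ 1) (λ i<j _ → <⇒≢ i<j ∘ +-cancelˡ-≡ (suc b) _ _)

oddParts evenParts : Partition → Partition
oddParts  []       = []
oddParts  (x ∷ xs) = x ∷ evenParts xs
evenParts []       = []
evenParts (x ∷ xs) = oddParts xs

oddSum≡size∘oddParts  : ∀ π → oddSum π ≡ size (oddParts π)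
evenSum≡size∘evenParts : ∀ π → evenSum π ≡ size (evenParts π)
oddSum≡size∘oddParts  []       = refl
oddSum≡size∘oddParts  (x ∷ xs) = cong (x +_) (evenSum≡size∘evenParts xs)
evenSum≡size∘evenParts []       = refl
evenSum≡size∘evenParts (x ∷ xs) = oddSum≡size∘oddParts xs

oddParts-PartsIn  : PartsIn N π → PartsIn N (oddParts π)
evenParts-PartsIn : PartsIn N π → PartsIn N (evenParts π)
oddParts-PartsIn  []                 = []
oddParts-PartsIn  ((1≤x ∷ x≤N) xs∈) = (1≤x ∷ x≤N) (evenParts-PartsIn xs∈)
evenParts-PartsIn []                 = []
evenParts-PartsIn ((_ ∷ _) xs∈)      = oddParts-PartsIn xs∈

oddParts-Gap : Gap 1 π → Gap 2 (oddParts π)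
oddParts-Gap gap[]                          = gap[]
oddParts-Gap gap[ x ]                       = gap[ x ]
oddParts-Gap (gap∷ {x} _ gap[ y ])           = gap[ x ]
oddParts-Gap (gap∷ y+1≤x (gap∷ z+1≤y zys)) = gap∷ (+-≤-trans 1 1 z+1≤y y+1≤x) (oddParts-Gap zys)

oddParts-InD : InD N π → InRR N (oddParts π)
oddParts-InD (gaps , parts) = oddParts-Gap gaps , oddParts-PartsIn parts

-- c = 0 encodes the absence of a second part.
trailing : ℕ → ℕ → Partition
trailing a zero    = a ∷ []
trailing a (suc c) = a ∷ suc c ∷ []

trailing-injective : ∀ {a c d} → trailing a c ≡ trailing a d → c ≡ d
trailing-injective {c = zero}  {zero}  refl = refl
trailing-injective {c = suc c} {suc d} refl = refl

oddParts∘trailing : ∀ a c → oddParts (trailing a c) ≡ a ∷ []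
oddParts∘trailing a zero    = refl
oddParts∘trailing a (suc c) = refl

oddParts⁻¹ : Partition → List Partition
oddParts⁻¹ []          = [] ∷ []
oddParts⁻¹ (a ∷ [])    = applyUpTo (trailing a) a
oddParts⁻¹ (a ∷ b ∷ μ) = cartesianProductWith (λ c ρ → a ∷ c ∷ ρ) (strictlyBetween b a) (oddParts⁻¹ (b ∷ μ))

length-oddParts⁻¹ : ∀ μ → length (oddParts⁻¹ μ) ≡ ω μ
length-oddParts⁻¹ []          = refl
length-oddParts⁻¹ (a ∷ [])    = length-applyUpTo (trailing a) a
length-oddParts⁻¹ (a ∷ b ∷ μ) = begin
  length (oddParts⁻¹ (a ∷ b ∷ μ))
    ≡⟨ length-cartesianProductWith _ (strictlyBetween b a) (oddParts⁻¹ (b ∷ μ)) ⟩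
  length (strictlyBetween b a) * length (oddParts⁻¹ (b ∷ μ))
    ≡⟨ cong₂ _*_ (length-applyUpTo (suc b +_) (a ∸ b ∸ 1)) (length-oddParts⁻¹ (b ∷ μ)) ⟩
  (a ∸ b ∸ 1) * ω (b ∷ μ)
    ∎
  where open ≡-Reasoning

oddParts⁻¹-unique : ∀ μ → Unique (oddParts⁻¹ μ)
oddParts⁻¹-unique []          = All.[] ∷ []
oddParts⁻¹-unique (a ∷ [])    = applyUpTo⁺₁ (trailing a) a (λ i<j _ → <⇒≢ i<j ∘ trailing-injective)
oddParts⁻¹-unique (a ∷ b ∷ μ) =
  cartesianProductWith⁺ _ (λ { refl → refl , refl }) (strictlyBetween-unique b a) (oddParts⁻¹-unique (b ∷ μ))

∈-oddParts⁻¹⇒oddParts : ∀ μ → π ∈ oddParts⁻¹ μ → oddParts π ≡ μ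
∈-oddParts⁻¹⇒oddParts []          (here refl) = refl
∈-oddParts⁻¹⇒oddParts (a ∷ [])    π∈ with ∈-applyUpTo⁻ (trailing a) π∈
... | c , _ , refl = oddParts∘trailing a c
∈-oddParts⁻¹⇒oddParts (a ∷ b ∷ μ) π∈ with ∈-cartesianProductWith⁻ _ (strictlyBetween b a) (oddParts⁻¹ (b ∷ μ)) π∈
... | c , ρ , _ , ρ∈ , refl = cong (a ∷_) (∈-oddParts⁻¹⇒oddParts (b ∷ μ) ρ∈)

oddParts⁻¹-head : ∀ {b} μ → π ∈ oddParts⁻¹ (b ∷ μ) → ∃ λ ρ → π ≡ b ∷ ρ
oddParts⁻¹-head {π = x ∷ ρ} {b} μ π∈ with ∈-oddParts⁻¹⇒oddParts (b ∷ μ) π∈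
... | refl = ρ , refl
oddParts⁻¹-head {π = []} {b} μ π∈ with () ← ∈-oddParts⁻¹⇒oddParts (b ∷ μ) π∈

trailing-InD : ∀ {a c} → 1 ≤ a → a ≤ N → c < a → InD N (trailing a c)
trailing-InD {a = a} {zero}  1≤a a≤N _   = gap[ a ] , (1≤a ∷ a≤N) []
trailing-InD {a = a} {suc c} 1≤a a≤N c<a =
  gap∷ (<⇒+1≤ c<a) gap[ suc c ] , (1≤a ∷ a≤N) ((s≤s z≤n ∷ ≤-trans (<⇒≤ c<a) a≤N) [])

∈-oddParts⁻¹⇒InD : ∀ μ → PartsIn N μ → π ∈ oddParts⁻¹ μ → InD N π
∈-oddParts⁻¹⇒InD []          []                 (here refl) = gap[] , []
∈-oddParts⁻¹⇒InD (a ∷ [])    ((1≤a ∷ a≤N) [])    π∈ with ∈-applyUpTo⁻ (trailing a) π∈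
... | c , c<a , refl = trailing-InD 1≤a a≤N c<a
∈-oddParts⁻¹⇒InD (a ∷ b ∷ μ) ((1≤a ∷ a≤N) parts) π∈
  with ∈-cartesianProductWith⁻ _ (strictlyBetween b a) (oddParts⁻¹ (b ∷ μ)) π∈
... | c , ρ , c∈ , ρ∈ , refl
  with oddParts⁻¹-head μ ρ∈ | ∈-oddParts⁻¹⇒InD (b ∷ μ) parts ρ∈ | ∈-strictlyBetween⁻ c∈
... | ρ′ , refl | ρgaps , ρparts | b<c , c<a =
  gap∷ (<⇒+1≤ c<a) (gap∷ (<⇒+1≤ b<c) ρgaps) ,
  (1≤a ∷ a≤N) ((≤-trans (s≤s z≤n) b<c ∷ ≤-trans (<⇒≤ c<a) a≤N) ρparts)

InD⇒∈-oddParts⁻¹ : InD N π → π ∈ oddParts⁻¹ (oddParts π)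
InD⇒∈-oddParts⁻¹ {π = []}         _ = here refl
InD⇒∈-oddParts⁻¹ {π = x ∷ []}     (_ , (1≤x ∷ _) _) = ∈-applyUpTo⁺ (trailing x) 1≤x
InD⇒∈-oddParts⁻¹ {π = x ∷ zero ∷ []} (_ , (_ ∷ _) ((() ∷ _) _))
InD⇒∈-oddParts⁻¹ {π = x ∷ suc y ∷ []} (gap∷ y+1≤x _ , _) = ∈-applyUpTo⁺ (trailing x) (+1≤⇒< {suc y} y+1≤x)
InD⇒∈-oddParts⁻¹ {π = x ∷ y ∷ z ∷ r} (gap∷ y+1≤x (gap∷ z+1≤y gaps) , (_ ∷ _) ((_ ∷ _) parts)) =
  ∈-cartesianProductWith⁺ _ (∈-strictlyBetween⁺ (+1≤⇒< z+1≤y) (+1≤⇒< y+1≤x)) (InD⇒∈-oddParts⁻¹ (gaps , parts))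

∈-concatMap-oddParts⁻¹⇔InD : ∀ {N μs π} → (∀ μ → μ ∈ μs ⇔ InRR N μ) → π ∈ concatMap oddParts⁻¹ μs ⇔ InD N π
∈-concatMap-oddParts⁻¹⇔InD {N} {μs} {π} μs⇔RR = mk⇔ to from
  where
  to : π ∈ concatMap oddParts⁻¹ μs → InD N π
  to π∈ with μ , μ∈ , π∈μ ← find (∈-concatMap⁻ oddParts⁻¹ π∈) =
    ∈-oddParts⁻¹⇒InD μ (proj₂ (Equivalence.to (μs⇔RR μ) μ∈)) π∈μ
  from : InD N π → π ∈ concatMap oddParts⁻¹ μs
  from π∈D = ∈-concatMap⁺ oddParts⁻¹
    (lose (Equivalence.from (μs⇔RR (oddParts π)) (oddParts-InD π∈D)) (InD⇒∈-oddParts⁻¹ π∈D))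

coeff-oddParts⁻¹ : ∀ n μ → coeff (oddParts⁻¹ μ) (λ _ → 1) oddSum n ≡ term ω size n μ
coeff-oddParts⁻¹ n μ = begin
  coeff (oddParts⁻¹ μ) (λ _ → 1) oddSum n
    ≡⟨ coeff-constExponent oddSum (size μ) n (oddParts⁻¹ μ) oddSum≡size ⟩
  (if size μ ≡ᵇ n then length (oddParts⁻¹ μ) else 0)
    ≡⟨ cong (λ k → if size μ ≡ᵇ n then k else 0) (length-oddParts⁻¹ μ) ⟩
  term ω size n μ
    ∎
  where
  open ≡-Reasoning
  oddSum≡size : ∀ {π} → π ∈ oddParts⁻¹ μ → oddSum π ≡ size μ
  oddSum≡size {π} π∈ = trans (oddSum≡size∘oddParts π) (cong size (∈-oddParts⁻¹⇒oddParts μ π∈))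

theorem6p2 : (N : ℕ) (LD LRR : List Partition)
    → Unique LD → (∀ π → (π ∈ LD) ⇔ InD N π)
    → Unique LRR → (∀ π → (π ∈ LRR) ⇔ InRR N π)
    → ∀ n → coeff LD (λ _ → 1) oddSum n ≡ coeff LRR ω size n
theorem6p2 N LD LRR LD! LD⇔D LRR! LRR⇔RR n = begin
  coeff LD (λ _ → 1) oddSum n
    ≡⟨ coeff-↭ _ _ n (unique-⇔⇒↭ LD! fibres! LD⇔fibres) ⟩
  coeff (concatMap oddParts⁻¹ LRR) (λ _ → 1) oddSum n
    ≡⟨ coeff-concatMap _ _ n oddParts⁻¹ LRR ⟩
  sum (map (λ μ → coeff (oddParts⁻¹ μ) (λ _ → 1) oddSum n) LRR)
    ≡⟨ cong sum (map-cong (coeff-oddParts⁻¹ n) LRR) ⟩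
  sum (map (term ω size n) LRR)
    ≡⟨ coeff≡sum ω size n LRR ⟨
  coeff LRR ω size n
    ∎
  where
  open ≡-Reasoning
  fibres! : Unique (concatMap oddParts⁻¹ LRR)
  fibres! = concatMap-unique oddParts⁻¹ LRR! oddParts⁻¹-unique
    (λ {μ} {ν} π∈μ π∈ν → trans (sym (∈-oddParts⁻¹⇒oddParts μ π∈μ)) (∈-oddParts⁻¹⇒oddParts ν π∈ν))
  LD⇔fibres : ∀ {π} → π ∈ LD ⇔ π ∈ concatMap oddParts⁻¹ LRR
  LD⇔fibres {π} = ⇔.trans (LD⇔D π) (⇔.sym (∈-concatMap-oddParts⁻¹⇔InD LRR⇔RR))
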